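{- Let $2k+1$ be a prime and let $G$ be a regular graph on $n$ vertices of degree $r>0$ that admits a $(2k+1)$-neighborhood balanced coloring. Then for any $(2k+1)$-neighborhood balanced coloring $\sigma$ of $G$ and every $i\in\{1,\dots,2k+1\}$, $\sigma(R_i)=\frac{n}{2k+1}$.
   Context: Graphs are finite and simple. For a prime $2k+1$ (with $k\ge 1$), a $(2k+1)$-neighborhood balanced coloring of a graph $G$ is an assignment to each vertex of one of $2k+1$ colors $R_1,\dots,R_{2k+1}$ such that every vertex has an equal number of neighbors of each color. For such a coloring $\sigma$, $\sigma(R_i)$ denotes the number of vertices colored $R_i$. -}

module Defs where

open import Data.Nat using (ℕ; suc; _+_; _*_)
open import Data.Bool using (Bool; true; false; _∧_)
open import Data.Fin using (Fin; _≟_)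
open import Data.Fin.Subset using (Subset)
open import Data.Vec.Functional using (Vector)
open import Data.Product using (Σ; _×_)
open import Relation.Binary.PropositionalEquality using (_≡_)
open import Relation.Nullary.Decidable using (⌊_⌋)

count : ∀ {n} → (Fin n → Bool) → ℕ
count {ℕ.zero} p = 0
count {suc n} p = (if' p Fin.zero) + count (λ i → p (Fin.suc i))
  where
  if' : ∀ {m} → (Fin (suc m) → Bool) → Fin (suc m) → ℕ
  if' q x with q x
  ... | true = 1
  ... | false = 0

record Graph (n : ℕ) : Set where
  field
    adj   : Fin n → Fin n → Bool
    sym   : ∀ u v → adj u v ≡ adj v u
    irrefl : ∀ v → adj v v ≡ false

open Graph public

deg : ∀ {n} → Graph n → Fin n → ℕ
deg G v = count (adj G v)

Regular : ∀ {n} → Graph n → ℕ → Set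
Regular G r = ∀ v → deg G v ≡ r

-- a coloring with m colors R_1..R_m (indexed by Fin m)
Coloring : ℕ → ℕ → Set
Coloring n m = Fin n → Fin m

nbrsOfColor : ∀ {n m} → Graph n → Coloring n m → Fin n → Fin m → ℕ
nbrsOfColor G σ v c = count (λ u → adj G v u ∧ ⌊ σ u ≟ c ⌋)

NeighborhoodBalanced : ∀ {n m} → Graph n → Coloring n m → Set
NeighborhoodBalanced G σ = ∀ v c d → nbrsOfColor G σ v c ≡ nbrsOfColor G σ v d

colorClassSize : ∀ {n m} → Coloring n m → Fin m → ℕ
colorClassSize σ c = count (λ u → ⌊ σ u ≟ c ⌋)

-- Count the pairs (v, u) with u a neighbour of v of colour c in two ways.
-- Grouping by v: in a balanced colouring each of the r neighbours of v is
-- spread evenly over the m colours, so v contributes r / m and the total is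
-- n r / m.  Grouping by u: each of the σ(R_c) vertices u of colour c is a
-- neighbour of exactly r vertices, so the total is r σ(R_c).  As r > 0,
-- σ(R_c) = n / m.
module Submission where

open import Defs hiding (sym)
import Algebra.Properties.Semiring.Sum
open import Data.Bool using (Bool; true; false; _∧_)
open import Data.Fin using (Fin; _≟_; punchIn)
open import Data.Fin.Properties using (punchInᵢ≢i)
open import Data.Nat using (ℕ; zero; suc; _+_; _*_; _>_; >-nonZero)
open import Data.Nat.Primality using (Prime)
open import Data.Nat.Properties using
  (+-*-semiring; *-identityʳ; *-comm; *-assoc; *-cancelˡ-≡)
open import Data.Product using (Σ)
open import Relation.Binary.PropositionalEquality
open import Relation.Nullary.Decidable using (⌊_⌋; yes; no)
open import Relation.Nullary.Negation using (contradiction)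

open Algebra.Properties.Semiring.Sum +-*-semiring using
  (sum-syntax; sum-cong-≗; sum-remove; sum-replicate-zero; ∑-comm;
   *-distribˡ-sum; *-distribʳ-sum)

𝟙 : Bool → ℕ
𝟙 true = 1
𝟙 false = 0

𝟙-∧ : ∀ a b → 𝟙 (a ∧ b) ≡ 𝟙 a * 𝟙 b
𝟙-∧ true true = refl
𝟙-∧ true false = refl
𝟙-∧ false b = refl

count≡∑𝟙 : ∀ {n} (p : Fin n → Bool) → count p ≡ ∑[ i < n ] 𝟙 (p i)
count≡∑𝟙 {zero} p = refl
count≡∑𝟙 {suc n} p with p Fin.zero
... | true = cong suc (count≡∑𝟙 (λ i → p (Fin.suc i)))
... | false = count≡∑𝟙 (λ i → p (Fin.suc i))

∑-const : ∀ n (x : ℕ) → ∑[ i < n ] x ≡ n * x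
∑-const zero x = refl
∑-const (suc n) x = cong (x +_) (∑-const n x)

𝟙-≟-≢ : ∀ {m} {x y : Fin m} → x ≢ y → 𝟙 ⌊ x ≟ y ⌋ ≡ 0
𝟙-≟-≢ {x = x} {y} x≢y with x ≟ y
... | yes x≡y = contradiction x≡y x≢y
... | no _ = refl

𝟙-≟-refl : ∀ {m} (x : Fin m) → 𝟙 ⌊ x ≟ x ⌋ ≡ 1
𝟙-≟-refl x with x ≟ x
... | yes _ = refl
... | no x≢x = contradiction refl x≢x

-- Split off the summand at y = x; the rest are indexed by punchIn x, which misses x.
∑-𝟙-≟ : ∀ {m} (x : Fin m) → ∑[ y < m ] 𝟙 ⌊ x ≟ y ⌋ ≡ 1
∑-𝟙-≟ {suc m} x = begin
  ∑[ y < suc m ] 𝟙 ⌊ x ≟ y ⌋                      ≡⟨ sum-remove {i = x} (λ y → 𝟙 ⌊ x ≟ y ⌋) ⟩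
  𝟙 ⌊ x ≟ x ⌋ + ∑[ j < m ] 𝟙 ⌊ x ≟ punchIn x j ⌋  ≡⟨ cong₂ _+_ (𝟙-≟-refl x) (sum-cong-≗ missed) ⟩
  1 + ∑[ j < m ] 0                                ≡⟨ cong suc (sum-replicate-zero m) ⟩
  1                                               ∎
  where
  open ≡-Reasoning
  missed : ∀ j → 𝟙 ⌊ x ≟ punchIn x j ⌋ ≡ 0
  missed j = 𝟙-≟-≢ (λ eq → punchInᵢ≢i x j (sym eq))

module _ {n m : ℕ} (G : Graph n) (σ : Coloring n m) where

  private
    A : Fin n → Fin n → ℕ
    A v u = 𝟙 (adj G v u)

    χ : Fin n → Fin m → ℕ
    χ u c = 𝟙 ⌊ σ u ≟ c ⌋

    open ≡-Reasoning

  nbrsOfColor≡∑ : ∀ v c → nbrsOfColor G σ v c ≡ ∑[ u < n ] (A v u * χ u c)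
  nbrsOfColor≡∑ v c =
    trans (count≡∑𝟙 (λ u → adj G v u ∧ ⌊ σ u ≟ c ⌋)) (sum-cong-≗ (λ u → 𝟙-∧ (adj G v u) _))

  ∑-nbrsOfColor≡deg : ∀ v → ∑[ c < m ] nbrsOfColor G σ v c ≡ deg G v
  ∑-nbrsOfColor≡deg v = begin
    ∑[ c < m ] nbrsOfColor G σ v c         ≡⟨ sum-cong-≗ (nbrsOfColor≡∑ v) ⟩
    ∑[ c < m ] ∑[ u < n ] (A v u * χ u c)  ≡⟨ ∑-comm (λ c u → A v u * χ u c) ⟩
    ∑[ u < n ] ∑[ c < m ] (A v u * χ u c)  ≡⟨ sum-cong-≗ (λ u → sym (*-distribˡ-sum (A v u) (χ u))) ⟩
    ∑[ u < n ] (A v u * ∑[ c < m ] χ u c)  ≡⟨ sum-cong-≗ (λ u → cong (A v u *_) (∑-𝟙-≟ (σ u))) ⟩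
    ∑[ u < n ] (A v u * 1)                 ≡⟨ sum-cong-≗ (λ u → *-identityʳ (A v u)) ⟩
    ∑[ u < n ] A v u                       ≡⟨ sym (count≡∑𝟙 (adj G v)) ⟩
    deg G v                                ∎

  ∑-nbrsOfColor≡∑-deg : ∀ c →
    ∑[ v < n ] nbrsOfColor G σ v c ≡ ∑[ u < n ] (deg G u * χ u c)
  ∑-nbrsOfColor≡∑-deg c = begin
    ∑[ v < n ] nbrsOfColor G σ v c           ≡⟨ sum-cong-≗ (λ v → nbrsOfColor≡∑ v c) ⟩
    ∑[ v < n ] ∑[ u < n ] (A v u * χ u c)    ≡⟨ ∑-comm (λ v u → A v u * χ u c) ⟩
    ∑[ u < n ] ∑[ v < n ] (A v u * χ u c)    ≡⟨ sum-cong-≗ (λ u → sym (*-distribʳ-sum (χ u c) (λ v → A v u))) ⟩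
    ∑[ u < n ] ((∑[ v < n ] A v u) * χ u c)  ≡⟨ sum-cong-≗ (λ u → cong (_* χ u c) (column≡deg u)) ⟩
    ∑[ u < n ] (deg G u * χ u c)             ∎
    where
    column≡deg : ∀ u → ∑[ v < n ] A v u ≡ deg G u
    column≡deg u = trans (sum-cong-≗ (λ v → cong 𝟙 (Graph.sym G v u))) (sym (count≡∑𝟙 (adj G u)))

  regular⇒∑-nbrsOfColor : ∀ {r} → Regular G r → ∀ c →
    ∑[ v < n ] nbrsOfColor G σ v c ≡ r * colorClassSize σ c
  regular⇒∑-nbrsOfColor {r} reg c = begin
    ∑[ v < n ] nbrsOfColor G σ v c  ≡⟨ ∑-nbrsOfColor≡∑-deg c ⟩
    ∑[ u < n ] (deg G u * χ u c)    ≡⟨ sum-cong-≗ (λ u → cong (_* χ u c) (reg u)) ⟩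
    ∑[ u < n ] (r * χ u c)          ≡⟨ *-distribˡ-sum r (λ u → χ u c) ⟨
    r * ∑[ u < n ] χ u c            ≡⟨ cong (r *_) (count≡∑𝟙 (λ u → ⌊ σ u ≟ c ⌋)) ⟨
    r * colorClassSize σ c          ∎

  balanced⇒nbrsOfColor*m≡deg : NeighborhoodBalanced G σ →
    ∀ v c → nbrsOfColor G σ v c * m ≡ deg G v
  balanced⇒nbrsOfColor*m≡deg bal v c = begin
    nbrsOfColor G σ v c * m         ≡⟨ *-comm _ m ⟩
    m * nbrsOfColor G σ v c         ≡⟨ ∑-const m _ ⟨
    ∑[ d < m ] nbrsOfColor G σ v c  ≡⟨ sum-cong-≗ (bal v c) ⟩
    ∑[ d < m ] nbrsOfColor G σ v d  ≡⟨ ∑-nbrsOfColor≡deg v ⟩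
    deg G v                         ∎

  regular-balanced⇒colorClassSize : ∀ {r} → r > 0 → Regular G r →
    NeighborhoodBalanced G σ → ∀ c → colorClassSize σ c * m ≡ n
  regular-balanced⇒colorClassSize {r} r>0 reg bal c =
    *-cancelˡ-≡ (colorClassSize σ c * m) n r {{>-nonZero r>0}} (begin
      r * (colorClassSize σ c * m)          ≡⟨ *-assoc r _ m ⟨
      r * colorClassSize σ c * m            ≡⟨ cong (_* m) (regular⇒∑-nbrsOfColor reg c) ⟨
      (∑[ v < n ] nbrsOfColor G σ v c) * m  ≡⟨ *-distribʳ-sum m (λ v → nbrsOfColor G σ v c) ⟩
      ∑[ v < n ] (nbrsOfColor G σ v c * m)  ≡⟨ sum-cong-≗ (λ v → trans (balanced⇒nbrsOfColor*m≡deg bal v c) (reg v)) ⟩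
      ∑[ v < n ] r                          ≡⟨ ∑-const n r ⟩
      n * r                                 ≡⟨ *-comm n r ⟩
      r * n                               ∎)

corollary2p3 : (k : ℕ) → Prime (2 * k + 1) →
    (n : ℕ) (G : Graph n) (r : ℕ) → r > 0 → Regular G r →
    Σ (Coloring n (2 * k + 1)) (λ τ → NeighborhoodBalanced G τ) →
    (σ : Coloring n (2 * k + 1)) → NeighborhoodBalanced G σ →
    ∀ i → colorClassSize σ i * (2 * k + 1) ≡ n
corollary2p3 k _ n G r r>0 reg _ σ bal =
  regular-balanced⇒colorClassSize G σ r>0 reg bal
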